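{- Let $T$ be a rooted tree with root $r$, and let $\mu:V(T)\to\mathbb{R}$ satisfy: (i) $\mu(v)\ge 1$ for every $v\in V(T)$; (ii) for every vertex $v$ with children $v_1,\dots,v_p$, $\sum_{i=1}^p\mu(v_i)\le\mu(v)$; (iii) there is a constant $0<C<1$ such that for every $v,v'$ with $v$ the parent of $v'$, $\mu(v')\le C\cdot\mu(v)$. Then $|V(T)|\le\left(1+\frac{1}{1-C}\right)\mu(r)-1$. -}

module Defs where

open import Level using (Level; _⊔_) renaming (suc to lsuc)
open import Data.Nat using (ℕ; zero; suc) renaming (_+_ to _+ℕ_)
open import Data.List using (List; []; _∷_)
open import Data.List.Relation.Unary.All using (All)
open import Algebra.Bundles using (CommutativeRing)
open import Relation.Binary.Structures using (IsTotalOrder)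
open import Relation.Nullary using (¬_)
open import Data.Product using (_×_; ∃)

-- Ordered fields (the stdlib has no reals; the theorem is stated for an
-- arbitrary ordered field, which includes ℝ).

record OrderedField (c ℓ₁ ℓ₂ : Level) : Set (lsuc (c ⊔ ℓ₁ ⊔ ℓ₂)) where
  field
    commutativeRing : CommutativeRing c ℓ₁
  open CommutativeRing commutativeRing public
  field
    _≤_         : Carrier → Carrier → Set ℓ₂
    isTotalOrder : IsTotalOrder _≈_ _≤_
    +-monoˡ-≤   : ∀ {x y} z → x ≤ y → (x + z) ≤ (y + z)
    *-nonneg    : ∀ {x y} → 0# ≤ x → 0# ≤ y → 0# ≤ (x * y)
    0≉1         : ¬ (0# ≈ 1#)
    inverse     : ∀ x → ¬ (x ≈ 0#) → ∃ λ y → (x * y) ≈ 1#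

  _<_ : Carrier → Carrier → Set (ℓ₁ ⊔ ℓ₂)
  x < y = (x ≤ y) × ¬ (x ≈ y)

  fromℕ : ℕ → Carrier
  fromℕ zero    = 0#
  fromℕ (suc n) = 1# + fromℕ n

-- Finite rooted trees whose vertices carry a label (the value of μ).

data Tree {a} (A : Set a) : Set a where
  node : A → List (Tree A) → Tree A

module _ {a} {A : Set a} where

  label : Tree A → A
  label (node x _) = x

  size  : Tree A → ℕ
  sizes : List (Tree A) → ℕ
  size (node _ ts) = suc (sizes ts)
  sizes []       = 0
  sizes (t ∷ ts) = size t +ℕ sizes ts

  data EveryVertex {p} (P : A → List (Tree A) → Set p) : Tree A → Set (a ⊔ p) where
    node : ∀ {x ts} → P x ts → All (EveryVertex P) ts → EveryVertex P (node x ts)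

module _ {c ℓ₁ ℓ₂} (F : OrderedField c ℓ₁ ℓ₂) where
  open OrderedField F

  childSum : List (Tree Carrier) → Carrier
  childSum []       = 0#
  childSum (t ∷ ts) = label t + childSum ts

  CondI : Carrier → List (Tree Carrier) → Set ℓ₂
  CondI μv _ = 1# ≤ μv

  CondII : Carrier → List (Tree Carrier) → Set ℓ₂
  CondII μv ts = childSum ts ≤ μv

  CondIII : Carrier → Carrier → List (Tree Carrier) → Set (c ⊔ ℓ₂)
  CondIII C μv ts = All (λ t → label t ≤ (C * μv)) ts

-- Writing D = 1/(1 − C), one proves |V(T)| + 1 ≤ (1 + D) μ(r) by induction on T.
-- A leaf needs 2 ≤ (1 + D) μ, which holds since μ ≥ 1 and D = 1 + C D ≥ 1.
-- At a vertex with k ≥ 2 children, |V(T)| + 1 = Σ |V(Tᵢ)| + 2 ≤ Σ (|V(Tᵢ)| + 1), so (ii)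
-- finishes. A vertex with one child v' adds a vertex, and (iii) pays for it:
-- (1 + D) μ − (1 + D) μ(v') ≥ (1 + D)(1 − C) μ = (1 − C) μ + μ ≥ 1.
module Submission where

open import Defs
open import Level using (Level)
open import Data.Nat using (zero; suc; z≤n; s≤s) renaming (_+_ to _+ℕ_; _≤_ to _≤ℕ_)
import Data.Nat.Properties as ℕ
open import Data.List using ([]; _∷_; length)
open import Data.List.Relation.Unary.All using (All; []; _∷_)
open import Data.Product using (proj₁)
open import Data.Sum using (inj₁; inj₂)
open import Data.Empty using (⊥-elim)
open import Relation.Binary.Bundles using (TotalOrder)
open import Relation.Binary.Structures using (IsTotalOrder)
open import Relation.Binary.PropositionalEquality using (_≡_; cong)
import Relation.Binary.PropositionalEquality as ≡
import Algebra.Solver.Ring.NaturalCoefficients.Default as NaturalCoefficients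
import Algebra.Properties.Group as GroupProperties
import Algebra.Properties.AbelianGroup as AbelianGroupProperties
import Algebra.Properties.Ring as RingProperties

module OrderedFieldProperties {c ℓ₁ ℓ₂ : Level} (F : OrderedField c ℓ₁ ℓ₂) where
  open OrderedField F
  open IsTotalOrder isTotalOrder using (total)
    renaming (refl to ≤-refl; trans to ≤-trans; reflexive to ≤-reflexive)
  open GroupProperties +-group using (//-rightDividesˡ)
  open AbelianGroupProperties +-abelianGroup using (xyx⁻¹≈y)
  open RingProperties ring using (-‿distribˡ-*; -‿involutive)

  totalOrder : TotalOrder c ℓ₁ ℓ₂
  totalOrder = record { isTotalOrder = isTotalOrder }

  open import Relation.Binary.Reasoning.PartialOrder (TotalOrder.poset totalOrder)

  +-mono-≤ : ∀ {x y u v} → x ≤ y → u ≤ v → (x + u) ≤ (y + v)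
  +-mono-≤ {x} {y} {u} {v} x≤y u≤v = begin
    x + u  ≤⟨ +-monoˡ-≤ u x≤y ⟩
    y + u  ≈⟨ +-comm y u ⟩
    u + y  ≤⟨ +-monoˡ-≤ y u≤v ⟩
    v + y  ≈⟨ +-comm v y ⟩
    y + v  ∎

  x≤y⇒0≤y-x : ∀ {x y} → x ≤ y → 0# ≤ (y - x)
  x≤y⇒0≤y-x {x} {y} x≤y = begin
    0#     ≈⟨ -‿inverseʳ x ⟨
    x - x  ≤⟨ +-monoˡ-≤ (- x) x≤y ⟩
    y - x  ∎

  z+x≤y⇒x≤y-z : ∀ {x y z} → (z + x) ≤ y → x ≤ (y - z)
  z+x≤y⇒x≤y-z {x} {y} {z} z+x≤y = begin
    x            ≈⟨ xyx⁻¹≈y z x ⟨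
    (z + x) - z  ≤⟨ +-monoˡ-≤ (- z) z+x≤y ⟩
    y - z        ∎

  *-monoˡ-≤-nonNeg : ∀ {x y z} → 0# ≤ z → x ≤ y → (x * z) ≤ (y * z)
  *-monoˡ-≤-nonNeg {x} {y} {z} 0≤z x≤y = begin
    x * z                    ≈⟨ +-identityˡ (x * z) ⟨
    0# + x * z               ≤⟨ +-monoˡ-≤ (x * z) (*-nonneg (x≤y⇒0≤y-x x≤y) 0≤z) ⟩
    (y - x) * z + x * z      ≈⟨ distribʳ z (y - x) x ⟨
    ((y - x) + x) * z        ≈⟨ *-congʳ (//-rightDividesˡ x y) ⟩
    y * z                    ∎

  *-monoʳ-≤-nonNeg : ∀ {x y z} → 0# ≤ z → x ≤ y → (z * x) ≤ (z * y)
  *-monoʳ-≤-nonNeg {x} {y} {z} 0≤z x≤y = begin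
    z * x  ≈⟨ *-comm z x ⟩
    x * z  ≤⟨ *-monoˡ-≤-nonNeg 0≤z x≤y ⟩
    y * z  ≈⟨ *-comm y z ⟩
    z * y  ∎

  -- If 1 ≤ 0 then 0 ≤ -1, hence 0 ≤ (-1)(-1) = 1.
  0≤1 : 0# ≤ 1#
  0≤1 with total 0# 1#
  ... | inj₁ 0≤1 = 0≤1
  ... | inj₂ 1≤0 = begin
    0#             ≤⟨ *-nonneg 0≤-1 0≤-1 ⟩
    - 1# * - 1#    ≈⟨ -‿distribˡ-* 1# (- 1#) ⟨
    - (1# * - 1#)  ≈⟨ -‿cong (*-identityˡ (- 1#)) ⟩
    - - 1#         ≈⟨ -‿involutive 1# ⟩
    1#             ∎
    where
    0≤-1 : 0# ≤ (- 1#)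
    0≤-1 = ≤-trans (x≤y⇒0≤y-x 1≤0) (≤-reflexive (+-identityˡ (- 1#)))

  fromℕ-mono-≤ : ∀ {m n} → m ≤ℕ n → fromℕ m ≤ fromℕ n
  fromℕ-mono-≤ {n = zero} z≤n = ≤-refl
  fromℕ-mono-≤ {n = suc n} z≤n = begin
    0#            ≈⟨ +-identityʳ 0# ⟨
    0# + 0#       ≤⟨ +-mono-≤ 0≤1 (fromℕ-mono-≤ {n = n} z≤n) ⟩
    1# + fromℕ n  ∎
  fromℕ-mono-≤ (s≤s m≤n) = +-mono-≤ ≤-refl (fromℕ-mono-≤ m≤n)

  fromℕ-homo-+ : ∀ m n → fromℕ (m +ℕ n) ≈ fromℕ m + fromℕ n
  fromℕ-homo-+ zero    n = sym (+-identityˡ (fromℕ n))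
  fromℕ-homo-+ (suc m) n = trans (+-congˡ (fromℕ-homo-+ m n)) (sym (+-assoc 1# (fromℕ m) (fromℕ n)))

module VertexBound {c ℓ₁ ℓ₂ : Level} (F : OrderedField c ℓ₁ ℓ₂) where
  open OrderedField F
  open OrderedFieldProperties F
  open IsTotalOrder isTotalOrder using (total; antisym)
    renaming (refl to ≤-refl; trans to ≤-trans)
  open NaturalCoefficients commutativeSemiring using (solve; _:=_; _:+_; _:*_; con)
  open GroupProperties +-group using (//-rightDividesˡ)
  open import Relation.Binary.Reasoning.PartialOrder (TotalOrder.poset totalOrder)

  module _ {C D : Carrier} (0≤C : 0# ≤ C) (C≤1 : C ≤ 1#) ([1-C]*D≈1 : (1# - C) * D ≈ 1#) where

    0≤1-C : 0# ≤ (1# - C)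
    0≤1-C = x≤y⇒0≤y-x C≤1

    0≤D : 0# ≤ D
    0≤D with total 0# D
    ... | inj₁ 0≤D = 0≤D
    ... | inj₂ D≤0 = ⊥-elim (0≉1 (antisym 0≤1 (begin
      1#             ≈⟨ [1-C]*D≈1 ⟨
      (1# - C) * D   ≤⟨ *-monoʳ-≤-nonNeg 0≤1-C D≤0 ⟩
      (1# - C) * 0#  ≈⟨ zeroʳ (1# - C) ⟩
      0#             ∎)))

    D≈1+C*D : D ≈ 1# + C * D
    D≈1+C*D = begin-equality
      D                       ≈⟨ *-identityˡ D ⟨
      1# * D                  ≈⟨ *-congʳ (//-rightDividesˡ C 1#) ⟨
      ((1# - C) + C) * D      ≈⟨ distribʳ D (1# - C) C ⟩
      (1# - C) * D + C * D    ≈⟨ +-congʳ [1-C]*D≈1 ⟩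
      1# + C * D              ∎

    1≤D : 1# ≤ D
    1≤D = begin
      1#          ≈⟨ +-identityʳ 1# ⟨
      1# + 0#     ≤⟨ +-mono-≤ ≤-refl (*-nonneg 0≤C 0≤D) ⟩
      1# + C * D  ≈⟨ D≈1+C*D ⟨
      D           ∎

    bound : Carrier → Carrier
    bound μ = (1# + D) * μ

    bound-mono-≤ : ∀ {x y} → x ≤ y → bound x ≤ bound y
    bound-mono-≤ = *-monoʳ-≤-nonNeg (begin
      0#       ≈⟨ +-identityʳ 0# ⟨
      0# + 0#  ≤⟨ +-mono-≤ 0≤1 0≤D ⟩
      1# + D   ∎)

    2≤bound : ∀ {μ} → 1# ≤ μ → fromℕ 2 ≤ bound μ
    2≤bound {μ} 1≤μ = begin
      1# + (1# + 0#)  ≈⟨ +-congˡ (+-identityʳ 1#) ⟩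
      1# + 1#         ≤⟨ +-mono-≤ ≤-refl 1≤D ⟩
      1# + D          ≈⟨ *-identityʳ (1# + D) ⟨
      bound 1#        ≤⟨ bound-mono-≤ 1≤μ ⟩
      bound μ         ∎

    1+bound[C*μ]≤bound[μ] : ∀ {μ} → 1# ≤ μ → (1# + bound (C * μ)) ≤ bound μ
    1+bound[C*μ]≤bound[μ] {μ} 1≤μ = begin
      1# + bound (C * μ)                       ≈⟨ +-congʳ (+-identityˡ 1#) ⟨
      (0# + 1#) + bound (C * μ)                ≤⟨ +-monoˡ-≤ (bound (C * μ)) (+-mono-≤ 0≤[1-C]*μ 1≤μ) ⟩
      ((1# - C) * μ + μ) + (1# + D) * (C * μ)  ≈⟨ rearrange (1# - C) C D μ ⟩
      ((1# - C) + C) * μ + (1# + C * D) * μ    ≈⟨ +-cong (*-congʳ (//-rightDividesˡ C 1#)) (*-congʳ (sym D≈1+C*D)) ⟩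
      1# * μ + D * μ                           ≈⟨ distribʳ μ 1# D ⟨
      bound μ                                  ∎
      where
      0≤[1-C]*μ : 0# ≤ ((1# - C) * μ)
      0≤[1-C]*μ = *-nonneg 0≤1-C (≤-trans 0≤1 1≤μ)
      rearrange : ∀ a c d m → ((a * m + m) + (1# + d) * (c * m)) ≈ ((a + c) * m + (1# + c * d) * m)
      rearrange = solve 4 (λ a c d m → (a :* m :+ m) :+ (con 1 :+ d) :* (c :* m)
                                    := (a :+ c) :* m :+ (con 1 :+ c :* d) :* m) refl

    suc-size≤bound : ∀ T → EveryVertex (CondI F) T → EveryVertex (CondII F) T →
                     EveryVertex (CondIII F C) T → fromℕ (suc (size T)) ≤ bound (label T)
    sizes+length≤bound : ∀ ts → All (EveryVertex (CondI F)) ts → All (EveryVertex (CondII F)) ts →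
                         All (EveryVertex (CondIII F C)) ts →
                         fromℕ (sizes ts +ℕ length ts) ≤ bound (childSum F ts)

    suc-size≤bound (node μ []) (node 1≤μ []) _ _ = 2≤bound 1≤μ
    suc-size≤bound (node μ (t ∷ [])) (node 1≤μ (tI ∷ [])) (node _ (tII ∷ []))
                   (node (t≤Cμ ∷ []) (tIII ∷ [])) = begin
      fromℕ (suc (suc (size t +ℕ 0)))  ≡⟨ cong (λ n → fromℕ (suc (suc n))) (ℕ.+-identityʳ (size t)) ⟩
      1# + fromℕ (suc (size t))        ≤⟨ +-mono-≤ ≤-refl (suc-size≤bound t tI tII tIII) ⟩
      1# + bound (label t)             ≤⟨ +-mono-≤ ≤-refl (bound-mono-≤ t≤Cμ) ⟩
      1# + bound (C * μ)               ≤⟨ 1+bound[C*μ]≤bound[μ] 1≤μ ⟩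
      bound μ                          ∎
    suc-size≤bound (node μ ts@(_ ∷ _ ∷ ts′)) (node _ tsI) (node childSum≤μ tsII) (node _ tsIII) = begin
      fromℕ (2 +ℕ sizes ts)          ≡⟨ cong fromℕ (ℕ.+-comm 2 (sizes ts)) ⟩
      fromℕ (sizes ts +ℕ 2)          ≤⟨ fromℕ-mono-≤ (ℕ.+-monoʳ-≤ (sizes ts) (ℕ.m≤m+n 2 (length ts′))) ⟩
      fromℕ (sizes ts +ℕ length ts)  ≤⟨ sizes+length≤bound ts tsI tsII tsIII ⟩
      bound (childSum F ts)          ≤⟨ bound-mono-≤ childSum≤μ ⟩
      bound μ                        ∎

    sizes+length≤bound [] [] [] [] = begin
      0#        ≈⟨ zeroʳ (1# + D) ⟨
      bound 0#  ∎
    sizes+length≤bound (t ∷ ts) (tI ∷ tsI) (tII ∷ tsII) (tIII ∷ tsIII) = begin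
      fromℕ (sizes (t ∷ ts) +ℕ length (t ∷ ts))
        ≡⟨ cong fromℕ (interchange (size t) (sizes ts) (length ts)) ⟩
      fromℕ (suc (size t) +ℕ (sizes ts +ℕ length ts))
        ≈⟨ fromℕ-homo-+ (suc (size t)) (sizes ts +ℕ length ts) ⟩
      fromℕ (suc (size t)) + fromℕ (sizes ts +ℕ length ts)
        ≤⟨ +-mono-≤ (suc-size≤bound t tI tII tIII) (sizes+length≤bound ts tsI tsII tsIII) ⟩
      bound (label t) + bound (childSum F ts)
        ≈⟨ distribˡ (1# + D) (label t) (childSum F ts) ⟨
      bound (childSum F (t ∷ ts))
        ∎
      where
      interchange : ∀ a b n → (a +ℕ b) +ℕ suc n ≡ suc a +ℕ (b +ℕ n)
      interchange a b n = ≡.trans (ℕ.+-suc (a +ℕ b) n) (cong suc (ℕ.+-assoc a b n))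

lemma12 : ∀ {c ℓ₁ ℓ₂ : Level} (F : OrderedField c ℓ₁ ℓ₂) →
          let open OrderedField F in
          (T : Tree Carrier) (C : Carrier) →
          EveryVertex (CondI F) T →
          EveryVertex (CondII F) T →
          EveryVertex (CondIII F C) T →
          0# < C → C < 1# →
          (D : Carrier) → ((1# - C) * D) ≈ 1# →
          fromℕ (size T) ≤ (((1# + D) * label T) - 1#)
lemma12 F T C i ii iii 0<C C<1 D [1-C]*D≈1 =
  z+x≤y⇒x≤y-z (suc-size≤bound (proj₁ 0<C) (proj₁ C<1) [1-C]*D≈1 T i ii iii)
  where
  open OrderedFieldProperties F
  open VertexBound F
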